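{- Let $G$ be a connected finite $d$-regular graph whose vertex set is partitioned into two sets $X$ and $Y$, and let $\mathcal{P}$ be the set of undirected paths of length at most $2$ in $G$ with one endpoint in $X$ and the other endpoint in $Y$. Then $$|\mathcal{P}|\leq \frac{|X||Y|}{|X|+|Y|}\left(d^2+d+\frac{1}{4}\right).$$
   Context: Graphs are simple. -}

module Defs where

open import Data.Nat using (ℕ; _+_; _*_)
open import Data.Bool using (Bool; true; false; if_then_else_; not)
open import Data.Fin using (Fin)
open import Data.List using (map; allFin)
open import Data.Nat.ListAction using (sum)
open import Relation.Binary.PropositionalEquality using (_≡_)

∑ : ∀ {n} → (Fin n → ℕ) → ℕ
∑ {n} f = sum (map f (allFin n))

[_] : Bool → ℕ
[ b ] = if b then 1 else 0

record SimpleGraph (n : ℕ) : Set where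
  field
    Adj     : Fin n → Fin n → Bool
    symm    : ∀ u v → Adj u v ≡ Adj v u
    loopless : ∀ v → Adj v v ≡ false
open SimpleGraph public

degree : ∀ {n} → SimpleGraph n → Fin n → ℕ
degree G u = ∑ (λ v → [ Adj G u v ])

Regular : ∀ {n} → SimpleGraph n → ℕ → Set
Regular G d = ∀ u → degree G u ≡ d

data Walk {n} (G : SimpleGraph n) : Fin n → Fin n → Set where
  nil  : ∀ {u} → Walk G u u
  cons : ∀ {u v w} → Adj G u v ≡ true → Walk G v w → Walk G u w

Connected : ∀ {n} → SimpleGraph n → Set
Connected G = ∀ u v → Walk G u v

card : ∀ {n} → (Fin n → Bool) → ℕ
card X = ∑ (λ v → [ X v ])

-- |P|: undirected paths of length ≤ 2 with one endpoint in X and the other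
-- in Y = V \ X.  Each such path is counted once by orienting it from its
-- X-endpoint u to its Y-endpoint w: either the edge u–w (length 1), or
-- u–v–w with u~v, v~w (length 2; u ≠ w since X ∩ Y = ∅, and v ≠ u, w by
-- looplessness).  Length-0 paths have equal endpoints, so never qualify.
pathCount : ∀ {n} → SimpleGraph n → (Fin n → Bool) → ℕ
pathCount G X =
  ∑ (λ u → ∑ (λ w → [ X u ] * [ not (X w) ] *
     ([ Adj G u w ] + ∑ (λ v → [ Adj G u v ] * [ Adj G v w ]))))

-- Let E be the number of X–Y edges and a v, b v the numbers of neighbours of v in X and in Y,
-- so that a v + b v = d.  Paths of length two are counted by their middle vertex, giving
-- |P| = E + ∑_v a v b v, and regularity turns this into the identity
-- |P| + ∑_{v ∈ X} (b v)² + ∑_{v ∈ Y} (a v)² = (2d + 1) E.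
-- By Cauchy–Schwarz the two square sums are at least E²/|X| and E²/|Y|, so
-- |P| ≤ (2d + 1) E − E² (|X| + |Y|)/(|X||Y|), and maximising this quadratic in E gives the bound.
module Submission where

open import Defs
open import Data.Nat using (ℕ; zero; suc; _+_; _*_; _≤_; z≤n)
open import Data.Nat.Properties
  using (+-*-semiring; *-commutativeSemigroup; +-assoc; *-assoc; *-zeroʳ; *-distribˡ-+;
         m+n≡0⇒m≡0; ≤-refl; ≤-total; m≤n+m; m≤n⇒∃[o]m+o≡n; +-mono-≤; *-monoʳ-≤;
         +-cancelʳ-≤; *-cancelˡ-≤; module ≤-Reasoning)
open import Data.Nat.Tactic.RingSolver using (solve; solve-∀)
open import Data.Bool using (Bool; true; false; not)
open import Data.Fin using (Fin; zero; suc)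
open import Data.List using ([]; _∷_; tabulate; allFin)
open import Data.List.Properties using (map-cong; map-tabulate)
import Data.Nat.ListAction as List
open import Data.Product using (_,_)
open import Data.Sum using (inj₁; inj₂)
open import Function using (_∘_; id)
open import Relation.Binary.PropositionalEquality
  using (_≡_; refl; sym; trans; cong; cong₂; subst; subst₂; module ≡-Reasoning)
import Algebra.Properties.Semiring.Sum +-*-semiring as VecSum
open import Algebra.Properties.CommutativeSemigroup *-commutativeSemigroup
  using () renaming (x∙yz≈y∙xz to x*[y*z]≡y*[x*z]; interchange to *-interchange)

∑≡sum : ∀ {n} (f : Fin n → ℕ) → ∑ f ≡ VecSum.sum f
∑≡sum f = trans (cong List.sum (map-tabulate id f)) (sum-tabulate f)
  where
  sum-tabulate : ∀ {n} (f : Fin n → ℕ) → List.sum (tabulate f) ≡ VecSum.sum f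
  sum-tabulate {zero}  f = refl
  sum-tabulate {suc n} f = cong (f zero +_) (sum-tabulate (f ∘ suc))

∑-cong : ∀ {n} {f g : Fin n → ℕ} → (∀ i → f i ≡ g i) → ∑ f ≡ ∑ g
∑-cong {n} f≗g = cong List.sum (map-cong f≗g (allFin n))

∑-distrib-+ : ∀ {n} (f g : Fin n → ℕ) → ∑ (λ i → f i + g i) ≡ ∑ f + ∑ g
∑-distrib-+ f g = begin
  ∑ (λ i → f i + g i)               ≡⟨ ∑≡sum (λ i → f i + g i) ⟩
  VecSum.sum (λ i → f i + g i)      ≡⟨ VecSum.∑-distrib-+ f g ⟩
  VecSum.sum f + VecSum.sum g       ≡⟨ sym (cong₂ _+_ (∑≡sum f) (∑≡sum g)) ⟩
  ∑ f + ∑ g                         ∎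
  where open ≡-Reasoning

*-distribˡ-∑ : ∀ {n} c (f : Fin n → ℕ) → c * ∑ f ≡ ∑ (λ i → c * f i)
*-distribˡ-∑ c f = begin
  c * ∑ f                       ≡⟨ cong (c *_) (∑≡sum f) ⟩
  c * VecSum.sum f              ≡⟨ VecSum.*-distribˡ-sum c f ⟩
  VecSum.sum (λ i → c * f i)    ≡⟨ sym (∑≡sum (λ i → c * f i)) ⟩
  ∑ (λ i → c * f i)             ∎
  where open ≡-Reasoning

*-distribʳ-∑ : ∀ {n} c (f : Fin n → ℕ) → ∑ f * c ≡ ∑ (λ i → f i * c)
*-distribʳ-∑ c f = begin
  ∑ f * c                       ≡⟨ cong (_* c) (∑≡sum f) ⟩
  VecSum.sum f * c              ≡⟨ VecSum.*-distribʳ-sum c f ⟩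
  VecSum.sum (λ i → f i * c)    ≡⟨ sym (∑≡sum (λ i → f i * c)) ⟩
  ∑ (λ i → f i * c)             ∎
  where open ≡-Reasoning

∑-comm : ∀ {m n} (f : Fin m → Fin n → ℕ) →
         ∑ (λ i → ∑ (λ j → f i j)) ≡ ∑ (λ j → ∑ (λ i → f i j))
∑-comm f = begin
  ∑ (λ i → ∑ (λ j → f i j))                      ≡⟨ ∑-cong (λ i → ∑≡sum (f i)) ⟩
  ∑ (λ i → VecSum.sum (λ j → f i j))             ≡⟨ ∑≡sum (λ i → VecSum.sum (f i)) ⟩
  VecSum.sum (λ i → VecSum.sum (λ j → f i j))    ≡⟨ VecSum.∑-comm f ⟩
  VecSum.sum (λ j → VecSum.sum (λ i → f i j))    ≡⟨ sym (∑≡sum (λ j → VecSum.sum (λ i → f i j))) ⟩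
  ∑ (λ j → VecSum.sum (λ i → f i j))             ≡⟨ sym (∑-cong (λ j → ∑≡sum (λ i → f i j))) ⟩
  ∑ (λ j → ∑ (λ i → f i j))                      ∎
  where open ≡-Reasoning

∑-mono-≤ : ∀ {n} {f g : Fin n → ℕ} → (∀ i → f i ≤ g i) → ∑ f ≤ ∑ g
∑-mono-≤ {f = f} {g} f≤g = subst₂ _≤_ (sym (∑≡sum f)) (sym (∑≡sum g)) (sum-mono-≤ f≤g)
  where
  sum-mono-≤ : ∀ {n} {f g : Fin n → ℕ} → (∀ i → f i ≤ g i) → VecSum.sum f ≤ VecSum.sum g
  sum-mono-≤ {zero}  _   = z≤n
  sum-mono-≤ {suc n} f≤g = +-mono-≤ (f≤g zero) (sum-mono-≤ (f≤g ∘ suc))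

∑*∑ : ∀ {m n} (f : Fin m → ℕ) (g : Fin n → ℕ) →
      ∑ f * ∑ g ≡ ∑ (λ i → ∑ (λ j → f i * g j))
∑*∑ f g = trans (*-distribʳ-∑ (∑ g) f) (∑-cong (λ i → *-distribˡ-∑ (f i) g))

∑∑-distrib-+ : ∀ {m n} (f g : Fin m → Fin n → ℕ) →
               ∑ (λ i → ∑ (λ j → f i j + g i j))
                 ≡ ∑ (λ i → ∑ (λ j → f i j)) + ∑ (λ i → ∑ (λ j → g i j))
∑∑-distrib-+ f g =
  trans (∑-cong (λ i → ∑-distrib-+ (f i) (g i))) (∑-distrib-+ (λ i → ∑ (f i)) (λ i → ∑ (g i)))

m≤n⇒2*m*n≤m*m+n*n : ∀ {m n} → m ≤ n → 2 * m * n ≤ m * m + n * n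
m≤n⇒2*m*n≤m*m+n*n {m} m≤n with m≤n⇒∃[o]m+o≡n m≤n
... | k , refl = begin
  2 * m * (m + k)               ≤⟨ m≤n+m _ (k * k) ⟩
  k * k + 2 * m * (m + k)       ≡⟨ solve (m ∷ k ∷ []) ⟩
  m * m + (m + k) * (m + k)     ∎
  where open ≤-Reasoning

2*m*n≤m*m+n*n : ∀ m n → 2 * m * n ≤ m * m + n * n
2*m*n≤m*m+n*n m n with ≤-total m n
... | inj₁ m≤n = m≤n⇒2*m*n≤m*m+n*n m≤n
... | inj₂ n≤m = begin
  2 * m * n      ≡⟨ solve (m ∷ n ∷ []) ⟩
  2 * n * m      ≤⟨ m≤n⇒2*m*n≤m*m+n*n n≤m ⟩
  n * n + m * m  ≡⟨ solve (m ∷ n ∷ []) ⟩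
  m * m + n * n  ∎
  where open ≤-Reasoning

∑-cauchy-schwarz : ∀ {n} (w t : Fin n → ℕ) →
  ∑ (λ i → w i * t i) * ∑ (λ i → w i * t i) ≤ ∑ w * ∑ (λ i → w i * (t i * t i))
-- Lagrange's argument: weight 2 t_i t_j ≤ t_i² + t_j² by w_i w_j and sum over all pairs (i, j).
∑-cauchy-schwarz {n} w t = *-cancelˡ-≤ 2 (begin
  2 * (∑ wt * ∑ wt)
    ≡⟨ cong (2 *_) (∑*∑ wt wt) ⟩
  2 * ∑ (λ i → ∑ (λ j → wt i * wt j))
    ≡⟨ *-distribˡ-∑∑ 2 (λ i j → wt i * wt j) ⟩
  ∑ (λ i → ∑ (λ j → 2 * (wt i * wt j)))
    ≤⟨ ∑-mono-≤ (λ i → ∑-mono-≤ (λ j → cross-term (w i) (t i) (w j) (t j))) ⟩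
  ∑ (λ i → ∑ (λ j → wtt i * w j + w i * wtt j))
    ≡⟨ ∑∑-distrib-+ (λ i j → wtt i * w j) (λ i j → w i * wtt j) ⟩
  ∑ (λ i → ∑ (λ j → wtt i * w j)) + ∑ (λ i → ∑ (λ j → w i * wtt j))
    ≡⟨ sym (cong₂ _+_ (∑*∑ wtt w) (∑*∑ w wtt)) ⟩
  ∑ wtt * ∑ w + ∑ w * ∑ wtt
    ≡⟨ x*y+y*x≡2*[y*x] (∑ wtt) (∑ w) ⟩
  2 * (∑ w * ∑ wtt)
    ∎)
  where
  open ≤-Reasoning
  wt wtt : Fin n → ℕ
  wt  i = w i * t i
  wtt i = w i * (t i * t i)
  *-distribˡ-∑∑ : ∀ {m n} c (f : Fin m → Fin n → ℕ) →
                  c * ∑ (λ i → ∑ (λ j → f i j)) ≡ ∑ (λ i → ∑ (λ j → c * f i j))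
  *-distribˡ-∑∑ c f = trans (*-distribˡ-∑ c (λ i → ∑ (f i))) (∑-cong (λ i → *-distribˡ-∑ c (f i)))
  cross-term : ∀ a s b u → 2 * (a * s * (b * u)) ≤ a * (s * s) * b + a * (b * (u * u))
  cross-term a s b u = begin
    2 * (a * s * (b * u))              ≡⟨ solve (a ∷ s ∷ b ∷ u ∷ []) ⟩
    a * b * (2 * s * u)                ≤⟨ *-monoʳ-≤ (a * b) (2*m*n≤m*m+n*n s u) ⟩
    a * b * (s * s + u * u)            ≡⟨ solve (a ∷ s ∷ b ∷ u ∷ []) ⟩
    a * (s * s) * b + a * (b * (u * u)) ∎
  x*y+y*x≡2*[y*x] : ∀ x y → x * y + y * x ≡ 2 * (y * x)
  x*y+y*x≡2*[y*x] = solve-∀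

-- 4 s a ≤ m² is the discriminant condition for the quadratic inequality a + s e² ≤ m e.
completing-square : ∀ a s m e → a + s * (e * e) ≤ m * e → 4 * s * a ≤ m * m
completing-square a s m e a+se²≤me = +-cancelʳ-≤ (2 * s * e * (2 * s * e)) _ _ (begin
  4 * s * a + 2 * s * e * (2 * s * e)       ≡⟨ solve (a ∷ s ∷ e ∷ []) ⟩
  4 * s * (a + s * (e * e))                 ≤⟨ *-monoʳ-≤ (4 * s) a+se²≤me ⟩
  4 * s * (m * e)                           ≡⟨ solve (s ∷ m ∷ e ∷ []) ⟩
  2 * m * (2 * s * e)                       ≤⟨ 2*m*n≤m*m+n*n m (2 * s * e) ⟩
  m * m + 2 * s * e * (2 * s * e)           ∎)
  where open ≤-Reasoning

p+a+b≡c*e⇒e*e≤0⇒p≡0 : ∀ p a b c e → p + a + b ≡ c * e → e * e ≤ 0 → p ≡ 0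
p+a+b≡c*e⇒e*e≤0⇒p≡0 p a b c zero p+a+b≡0 _ =
  m+n≡0⇒m≡0 p (m+n≡0⇒m≡0 (p + a) (trans p+a+b≡0 (*-zeroʳ c)))

quadratic-bound-scaled : ∀ x y p a b c e → p + a + b ≡ c * e → e * e ≤ x * a → e * e ≤ y * b →
                         x * y * (4 * p * (x + y)) ≤ x * y * (x * y * (c * c))
quadratic-bound-scaled x y p a b c e p+a+b≡ce e²≤xa e²≤yb = begin
  x * y * (4 * p * (x + y))      ≡⟨ solve (x ∷ y ∷ p ∷ []) ⟩
  4 * (x + y) * (x * y * p)      ≤⟨ completing-square (x * y * p) (x + y) (x * y * c) e weighted ⟩
  x * y * c * (x * y * c)        ≡⟨ solve (x ∷ y ∷ c ∷ []) ⟩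
  x * y * (x * y * (c * c))      ∎
  where
  open ≤-Reasoning
  weighted : x * y * p + (x + y) * (e * e) ≤ x * y * c * e
  weighted = begin
    x * y * p + (x + y) * (e * e)               ≡⟨ solve (x ∷ y ∷ p ∷ e ∷ []) ⟩
    x * y * p + (y * (e * e) + x * (e * e))     ≤⟨ +-mono-≤ (≤-refl {x * y * p})
                                                     (+-mono-≤ (*-monoʳ-≤ y e²≤xa) (*-monoʳ-≤ x e²≤yb)) ⟩
    x * y * p + (y * (x * a) + x * (y * b))     ≡⟨ solve (x ∷ y ∷ p ∷ a ∷ b ∷ []) ⟩
    x * y * (p + a + b)                         ≡⟨ cong (x * y *_) p+a+b≡ce ⟩
    x * y * (c * e)                             ≡⟨ solve (x ∷ y ∷ c ∷ e ∷ []) ⟩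
    x * y * c * e                               ∎

quadratic-bound : ∀ x y p a b c e → p + a + b ≡ c * e → e * e ≤ x * a → e * e ≤ y * b →
                  4 * p * (x + y) ≤ x * y * (c * c)
quadratic-bound zero y p a b c e p+a+b≡ce e²≤0 _
  rewrite p+a+b≡c*e⇒e*e≤0⇒p≡0 p a b c e p+a+b≡ce e²≤0 = z≤n
quadratic-bound (suc x) zero p a b c e p+a+b≡ce _ e²≤0
  rewrite p+a+b≡c*e⇒e*e≤0⇒p≡0 p a b c e p+a+b≡ce e²≤0 = z≤n
quadratic-bound x@(suc _) y@(suc _) p a b c e p+a+b≡ce e²≤xa e²≤yb =
  *-cancelˡ-≤ (x * y) (quadratic-bound-scaled x y p a b c e p+a+b≡ce e²≤xa e²≤yb)

[b]*k+[¬b]*k≡k : ∀ b k → [ b ] * k + [ not b ] * k ≡ k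
[b]*k+[¬b]*k≡k true  k = solve (k ∷ [])
[b]*k+[¬b]*k≡k false k = solve (k ∷ [])

m*n+[b]*n²+[¬b]*m²≡[m+n]*[[b]*n+[¬b]*m] : ∀ b m n →
  m * n + [ b ] * (n * n) + [ not b ] * (m * m) ≡ (m + n) * ([ b ] * n + [ not b ] * m)
m*n+[b]*n²+[¬b]*m²≡[m+n]*[[b]*n+[¬b]*m] true  m n = solve (m ∷ n ∷ [])
m*n+[b]*n²+[¬b]*m²≡[m+n]*[[b]*n+[¬b]*m] false m n = solve (m ∷ n ∷ [])

module _ {n} (G : SimpleGraph n) where

  [Adj]-symm : ∀ u v → [ Adj G u v ] ≡ [ Adj G v u ]
  [Adj]-symm u v = cong [_] (symm G u v)

  degreeIn : (Fin n → Bool) → Fin n → ℕ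
  degreeIn S v = ∑ λ u → [ S u ] * [ Adj G v u ]

  edgesBetween : (Fin n → Bool) → (Fin n → Bool) → ℕ
  edgesBetween S T = ∑ λ u → [ S u ] * degreeIn T u

  twoPathsBetween : (Fin n → Bool) → (Fin n → Bool) → ℕ
  twoPathsBetween S T = ∑ λ v → degreeIn S v * degreeIn T v

  degreeSquaresIn : (Fin n → Bool) → (Fin n → Bool) → ℕ
  degreeSquaresIn S T = ∑ λ v → [ S v ] * (degreeIn T v * degreeIn T v)

  degreeIn-complement : ∀ S v → degreeIn S v + degreeIn (not ∘ S) v ≡ degree G v
  degreeIn-complement S v = begin
    degreeIn S v + degreeIn (not ∘ S) v
      ≡⟨ sym (∑-distrib-+ (λ u → [ S u ] * [ Adj G v u ]) (λ u → [ not (S u) ] * [ Adj G v u ])) ⟩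
    ∑ (λ u → [ S u ] * [ Adj G v u ] + [ not (S u) ] * [ Adj G v u ])
      ≡⟨ ∑-cong (λ u → [b]*k+[¬b]*k≡k (S u) [ Adj G v u ]) ⟩
    degree G v
      ∎
    where open ≡-Reasoning

  edgesBetween-comm : ∀ S T → edgesBetween S T ≡ edgesBetween T S
  edgesBetween-comm S T = begin
    ∑ (λ u → [ S u ] * ∑ (λ w → [ T w ] * [ Adj G u w ]))
      ≡⟨ ∑-cong (λ u → *-distribˡ-∑ [ S u ] (λ w → [ T w ] * [ Adj G u w ])) ⟩
    ∑ (λ u → ∑ (λ w → [ S u ] * ([ T w ] * [ Adj G u w ])))
      ≡⟨ ∑-comm (λ u w → [ S u ] * ([ T w ] * [ Adj G u w ])) ⟩
    ∑ (λ w → ∑ (λ u → [ S u ] * ([ T w ] * [ Adj G u w ])))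
      ≡⟨ ∑-cong (λ w → ∑-cong (λ u → swap u w)) ⟩
    ∑ (λ w → ∑ (λ u → [ T w ] * ([ S u ] * [ Adj G w u ])))
      ≡⟨ sym (∑-cong (λ w → *-distribˡ-∑ [ T w ] (λ u → [ S u ] * [ Adj G w u ]))) ⟩
    ∑ (λ w → [ T w ] * ∑ (λ u → [ S u ] * [ Adj G w u ]))
      ∎
    where
    open ≡-Reasoning
    swap : ∀ u w → [ S u ] * ([ T w ] * [ Adj G u w ]) ≡ [ T w ] * ([ S u ] * [ Adj G w u ])
    swap u w rewrite [Adj]-symm u w = x*[y*z]≡y*[x*z] [ S u ] [ T w ] [ Adj G w u ]

  edgesBetween-cauchy-schwarz : ∀ S T →
    edgesBetween S T * edgesBetween S T ≤ card S * degreeSquaresIn S T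
  edgesBetween-cauchy-schwarz S T = ∑-cauchy-schwarz (λ v → [ S v ]) (degreeIn T)

  ∑∑-edges≡edgesBetween : ∀ S T →
    ∑ (λ u → ∑ (λ w → [ S u ] * [ T w ] * [ Adj G u w ])) ≡ edgesBetween S T
  ∑∑-edges≡edgesBetween S T = ∑-cong λ u → begin
    ∑ (λ w → [ S u ] * [ T w ] * [ Adj G u w ])
      ≡⟨ ∑-cong (λ w → *-assoc [ S u ] [ T w ] [ Adj G u w ]) ⟩
    ∑ (λ w → [ S u ] * ([ T w ] * [ Adj G u w ]))
      ≡⟨ sym (*-distribˡ-∑ [ S u ] (λ w → [ T w ] * [ Adj G u w ])) ⟩
    [ S u ] * degreeIn T u
      ∎
    where open ≡-Reasoning

  ∑∑-twoPaths≡twoPathsBetween : ∀ S T →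
    ∑ (λ u → ∑ (λ w → [ S u ] * [ T w ] * ∑ (λ v → [ Adj G u v ] * [ Adj G v w ])))
      ≡ twoPathsBetween S T
  ∑∑-twoPaths≡twoPathsBetween S T = begin
    ∑ (λ u → ∑ (λ w → [ S u ] * [ T w ] * ∑ (λ v → [ Adj G u v ] * [ Adj G v w ])))
      ≡⟨ ∑-cong (λ u → ∑-cong (λ w → split-at-middle u w)) ⟩
    ∑ (λ u → ∑ (λ w → ∑ (λ v → start u v * end v w)))
      ≡⟨ ∑-cong (λ u → ∑-comm (λ w v → start u v * end v w)) ⟩
    ∑ (λ u → ∑ (λ v → ∑ (λ w → start u v * end v w)))
      ≡⟨ ∑-comm (λ u v → ∑ (λ w → start u v * end v w)) ⟩
    ∑ (λ v → ∑ (λ u → ∑ (λ w → start u v * end v w)))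
      ≡⟨ sym (∑-cong (λ v → ∑*∑ (λ u → start u v) (end v))) ⟩
    ∑ (λ v → ∑ (λ u → start u v) * ∑ (end v))
      ≡⟨ ∑-cong (λ v → cong (_* ∑ (end v)) (∑-cong (λ u → cong ([ S u ] *_) ([Adj]-symm u v)))) ⟩
    twoPathsBetween S T
      ∎
    where
    open ≡-Reasoning
    start end : Fin n → Fin n → ℕ
    start u v = [ S u ] * [ Adj G u v ]
    end   v w = [ T w ] * [ Adj G v w ]
    split-at-middle : ∀ u w → [ S u ] * [ T w ] * ∑ (λ v → [ Adj G u v ] * [ Adj G v w ])
                              ≡ ∑ (λ v → start u v * end v w)
    split-at-middle u w = trans (*-distribˡ-∑ ([ S u ] * [ T w ]) (λ v → [ Adj G u v ] * [ Adj G v w ]))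
      (∑-cong (λ v → *-interchange [ S u ] [ T w ] [ Adj G u v ] [ Adj G v w ]))

  pathCount≡edges+twoPaths : ∀ X →
    pathCount G X ≡ edgesBetween X (not ∘ X) + twoPathsBetween X (not ∘ X)
  pathCount≡edges+twoPaths X = begin
    pathCount G X
      ≡⟨ ∑-cong (λ u → ∑-cong (λ w → *-distribˡ-+ ([ X u ] * [ Y w ]) [ Adj G u w ] (twoPaths u w))) ⟩
    ∑ (λ u → ∑ (λ w → [ X u ] * [ Y w ] * [ Adj G u w ] + [ X u ] * [ Y w ] * twoPaths u w))
      ≡⟨ ∑∑-distrib-+ (λ u w → [ X u ] * [ Y w ] * [ Adj G u w ])
                      (λ u w → [ X u ] * [ Y w ] * twoPaths u w) ⟩
    ∑ (λ u → ∑ (λ w → [ X u ] * [ Y w ] * [ Adj G u w ]))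
      + ∑ (λ u → ∑ (λ w → [ X u ] * [ Y w ] * twoPaths u w))
      ≡⟨ cong₂ _+_ (∑∑-edges≡edgesBetween X Y) (∑∑-twoPaths≡twoPathsBetween X Y) ⟩
    edgesBetween X Y + twoPathsBetween X Y
      ∎
    where
    open ≡-Reasoning
    Y : Fin n → Bool
    Y = not ∘ X
    twoPaths : Fin n → Fin n → ℕ
    twoPaths u w = ∑ (λ v → [ Adj G u v ] * [ Adj G v w ])

  module _ {d} (regular : Regular G d) (X : Fin n → Bool) where

    private
      Y : Fin n → Bool
      Y = not ∘ X

    twoPaths+degreeSquares≡2d*edges :
      twoPathsBetween X Y + degreeSquaresIn X Y + degreeSquaresIn Y X
        ≡ d * edgesBetween X Y + d * edgesBetween X Y
    twoPaths+degreeSquares≡2d*edges = begin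
      ∑ (λ v → a v * b v) + ∑ (λ v → [ X v ] * (b v * b v)) + ∑ (λ v → [ Y v ] * (a v * a v))
        ≡⟨ cong (_+ degreeSquaresIn Y X)
                (sym (∑-distrib-+ (λ v → a v * b v) (λ v → [ X v ] * (b v * b v)))) ⟩
      ∑ (λ v → a v * b v + [ X v ] * (b v * b v)) + ∑ (λ v → [ Y v ] * (a v * a v))
        ≡⟨ sym (∑-distrib-+ (λ v → a v * b v + [ X v ] * (b v * b v)) (λ v → [ Y v ] * (a v * a v))) ⟩
      ∑ (λ v → a v * b v + [ X v ] * (b v * b v) + [ Y v ] * (a v * a v))
        ≡⟨ ∑-cong at-vertex ⟩
      ∑ (λ v → d * ([ X v ] * b v) + d * ([ Y v ] * a v))
        ≡⟨ ∑-distrib-+ (λ v → d * ([ X v ] * b v)) (λ v → d * ([ Y v ] * a v)) ⟩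
      ∑ (λ v → d * ([ X v ] * b v)) + ∑ (λ v → d * ([ Y v ] * a v))
        ≡⟨ sym (cong₂ _+_ (*-distribˡ-∑ d (λ v → [ X v ] * b v)) (*-distribˡ-∑ d (λ v → [ Y v ] * a v))) ⟩
      d * edgesBetween X Y + d * edgesBetween Y X
        ≡⟨ cong (λ e → d * edgesBetween X Y + d * e) (edgesBetween-comm Y X) ⟩
      d * edgesBetween X Y + d * edgesBetween X Y
        ∎
      where
      open ≡-Reasoning
      a b : Fin n → ℕ
      a = degreeIn X
      b = degreeIn Y
      at-vertex : ∀ v → a v * b v + [ X v ] * (b v * b v) + [ Y v ] * (a v * a v)
                        ≡ d * ([ X v ] * b v) + d * ([ Y v ] * a v)
      at-vertex v = begin
        a v * b v + [ X v ] * (b v * b v) + [ Y v ] * (a v * a v)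
          ≡⟨ m*n+[b]*n²+[¬b]*m²≡[m+n]*[[b]*n+[¬b]*m] (X v) (a v) (b v) ⟩
        (a v + b v) * ([ X v ] * b v + [ Y v ] * a v)
          ≡⟨ cong (_* ([ X v ] * b v + [ Y v ] * a v)) (trans (degreeIn-complement X v) (regular v)) ⟩
        d * ([ X v ] * b v + [ Y v ] * a v)
          ≡⟨ *-distribˡ-+ d ([ X v ] * b v) ([ Y v ] * a v) ⟩
        d * ([ X v ] * b v) + d * ([ Y v ] * a v)
          ∎

    pathCount+degreeSquares≡[2d+1]*edges :
      pathCount G X + degreeSquaresIn X Y + degreeSquaresIn Y X ≡ (2 * d + 1) * edgesBetween X Y
    pathCount+degreeSquares≡[2d+1]*edges = begin
      pathCount G X + sqX + sqY
        ≡⟨ cong (λ p → p + sqX + sqY) (pathCount≡edges+twoPaths X) ⟩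
      e + twoPathsBetween X Y + sqX + sqY
        ≡⟨ trans (cong (_+ sqY) (+-assoc e (twoPathsBetween X Y) sqX)) (+-assoc e _ sqY) ⟩
      e + (twoPathsBetween X Y + sqX + sqY)
        ≡⟨ cong (e +_) twoPaths+degreeSquares≡2d*edges ⟩
      e + (d * e + d * e)
        ≡⟨ m+[n*m+n*m]≡[2*n+1]*m e d ⟩
      (2 * d + 1) * e
        ∎
      where
      open ≡-Reasoning
      e sqX sqY : ℕ
      e   = edgesBetween X Y
      sqX = degreeSquaresIn X Y
      sqY = degreeSquaresIn Y X
      m+[n*m+n*m]≡[2*n+1]*m : ∀ m n → m + (n * m + n * m) ≡ (2 * n + 1) * m
      m+[n*m+n*m]≡[2*n+1]*m = solve-∀

lemma4p4 : (n d : ℕ) (G : SimpleGraph n) → Connected G → Regular G d →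
    (X : Fin n → Bool) →
    4 * pathCount G X * (card X + card (λ v → not (X v)))
    ≤ card X * card (λ v → not (X v)) * (4 * (d * d) + 4 * d + 1)
lemma4p4 n d G _ regular X = begin
  4 * pathCount G X * (card X + card Y)
    ≤⟨ quadratic-bound (card X) (card Y) (pathCount G X) (degreeSquaresIn G X Y) (degreeSquaresIn G Y X)
         (2 * d + 1) (edgesBetween G X Y)
         (pathCount+degreeSquares≡[2d+1]*edges G regular X)
         (edgesBetween-cauchy-schwarz G X Y)
         (subst (λ e → e * e ≤ card Y * degreeSquaresIn G Y X) (edgesBetween-comm G Y X)
                (edgesBetween-cauchy-schwarz G Y X)) ⟩
  card X * card Y * ((2 * d + 1) * (2 * d + 1))
    ≡⟨ cong (card X * card Y *_) (solve (d ∷ [])) ⟩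
  card X * card Y * (4 * (d * d) + 4 * d + 1)
    ∎
  where
  open ≤-Reasoning
  Y : Fin n → Bool
  Y = not ∘ X
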